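{- Let $A=\{a_1,\dots,a_{3r}\}$ be a 3-partition instance and $(G,R')$ the ridesharing instance constructed from it as in the context. Then $A$ has a solution (a partition into $r$ triples each summing to $M$) if and only if $(G,R')$ has a solution $(S,\sigma)$ with $3r\le|S|<3r+rM$, where $S$ is the set of drivers.
   Context: Ridesharing problem. A road network is an undirected graph $G$ with nonnegative edge lengths (travel time proportional to distance). An instance consists of $G$ and a set of trips, each trip $i$ having source $s_i$, destination $t_i$, capacity $n_i\ge0$ (seats for passengers), detour limit $d_i$, a set of preferred $s_i$–$t_i$ paths, stop limit $\delta_i$ (maximum number of pick-up stops at locations other than $s_i$), earliest departure time $\alpha_i$, latest arrival time $\beta_i$. Trip $i$ can serve $\sigma(i)\ni i$ if $i$'s vehicle can pick up each $j\in\sigma(i)\setminus\{i\}$ at $s_j$ (not before $\alpha_j$) and deliver each $j\in\sigma(i)$ to $t_j$ by $\beta_j$, with detour at most $d_i$ from its preferred path, at most $\delta_i$ pick-up stops, no re-taking of passengers ($|\sigma(i)|\le n_i+1$). A solution $(S,\sigma)$: $S$ a set of drivers, $\sigma(i)$ ($i\in S$) served by $i$, pairwise disjoint, covering all trips. 3-partition instance: $3r$ positive integers, $r\ge 2$, $\sum a_i=rM$, $M/4<a_i<M/2$. Construction of $(G,R')$: $V(G)=\{D,u_1,\dots,u_{3r},v_1,\dots,v_r\}$, edges $\{u_i,v_1\}$ ($1\le i\le 3r$), $\{v_i,v_{i+1}\}$ ($1\le i\le r-1$), $\{v_r,D\}$, all of length 1. $\alpha<\beta$ are time constants allowing every trip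 to reach $D$ in time. For $1\le i\le 3r$: trip $i$ has $s_i=u_i$, $t_i=D$, $n_i=a_i\cdot rM$, $d_i=0$, $\delta_i=1$, $\alpha_i=\alpha$, $\beta_i=\beta$, unique preferred path $u_i,v_1,\dots,v_r,D$. For each $1\le j\le r$ there are $rM^2$ additional trips with source $v_j$, destination $D$, capacity $0$, detour limit $0$, stop limit $0$, departure $\alpha$, arrival $\beta$, unique preferred path $v_j,v_{j+1},\dots,v_r,D$. -}

module Defs where

open import Data.Nat using (ℕ; zero; suc; _+_; _*_; _≤_; _<_)
open import Data.Fin as Fin using (Fin; zero; suc; inject₁; fromℕ; splitAt; remQuot)
open import Data.Fin.Subset as Sub using (Subset; ∣_∣)
open import Data.List using (List; []; _∷_; length; tabulate)
open import Data.Nat.ListAction using (sum)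
open import Data.List.Membership.Propositional as L using ()
open import Data.Product using (Σ; ∃; ∃-syntax; _×_; _,_; proj₁)
open import Data.Sum using (_⊎_; inj₁; inj₂; [_,_]′)
open import Data.Empty using (⊥)
open import Relation.Nullary using (¬_)
open import Relation.Binary.PropositionalEquality using (_≡_; _≢_; refl)
open import Function.Definitions using (Bijective)

record Graph : Set₁ where
  field
    Vertex : Set
    Edge   : Set
    ends   : Edge → Vertex × Vertex
    len    : Edge → ℕ                 -- its length (= travel time)
open Graph public

-- edge e joins x and y (in either orientation: the graph is undirected)
Joins : (G : Graph) → Edge G → Vertex G → Vertex G → Set
Joins G e x y = ends G e ≡ (x , y) ⊎ ends G e ≡ (y , x)

data Walk (G : Graph) : Vertex G → Vertex G → Set where
  []   : ∀ {x} → Walk G x x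
  step : ∀ {x y z} (e : Edge G) → Joins G e x y → Walk G y z → Walk G x z

steps : ∀ {G x y} → Walk G x y → ℕ
steps []           = zero
steps (step _ _ W) = suc (steps W)

lengthW : ∀ {G x y} → Walk G x y → ℕ
lengthW []              = zero
lengthW {G} (step e _ W) = len G e + lengthW W

-- the p-th vertex visited by the walk (p = 0 is the start)
vertAt : ∀ {G x y} (W : Walk G x y) → Fin (suc (steps W)) → Vertex G
vertAt {x = x} []           zero    = x
vertAt {x = x} (step _ _ W) zero    = x
vertAt         (step _ _ W) (suc p) = vertAt W p

distAt : ∀ {G x y} (W : Walk G x y) → Fin (suc (steps W)) → ℕ
distAt []               zero    = zero
distAt (step _ _ W)     zero    = zero
distAt {G} (step e _ W) (suc p) = len G e + distAt W p

record Trip (G : Graph) : Set where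
  field
    src dst  : Vertex G
    cap      : ℕ
    detour   : ℕ
    stopLim  : ℕ
    early    : ℕ
    late     : ℕ
    pref     : List (Walk G src dst)
open Trip public

record Instance : Set₁ where
  field
    graph : Graph
    N     : ℕ
    trip  : Fin N → Trip graph
open Instance public

-- The vehicle of i leaves s_i at time t₀ ≥ α_i and drives along the route W
-- (travel time = distance); it picks up every j ∈ X at s_j (at a time ≥ α_j)
-- and later delivers j at t_j (at a time ≤ β_j); it arrives at t_i by β_i;
-- the route is at most d_i longer than a preferred path of i; the pick-up
-- locations other than s_i are at most δ_i many; and |X| ≤ n_i + 1.
CanServe : (I : Instance) → Fin (N I) → Subset (N I) → Set
CanServe I i X =
  Σ (Walk G (src T) (dst T)) λ W →
  Σ ℕ λ t₀ →
    early T ≤ t₀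
  × t₀ + lengthW W ≤ late T
  × (∃[ P ] (P L.∈ pref T × lengthW W ≤ lengthW P + detour T))
  × ∣ X ∣ ≤ cap T + 1
  × (∃[ Ls ] (length Ls ≤ stopLim T
              × (∀ j → j Sub.∈ X → src (trip I j) ≢ src T → src (trip I j) L.∈ Ls)))
  × (∀ j → j Sub.∈ X →
       ∃[ p ] ∃[ q ] (p Fin.≤ q
         × vertAt W p ≡ src (trip I j)
         × vertAt W q ≡ dst (trip I j)
         × early (trip I j) ≤ t₀ + distAt W p
         × t₀ + distAt W q ≤ late (trip I j)))
  where
    G = graph I
    T = trip I i

-- (S , σ) is a solution: S the set of drivers, σ(i) the trips served by i ∈ S
IsSolution : (I : Instance) → Subset (N I) → (Fin (N I) → Subset (N I)) → Set
IsSolution I S σ =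
    (∀ i → i Sub.∈ S → i Sub.∈ σ i × CanServe I i (σ i))
  × (∀ i i' → i Sub.∈ S → i' Sub.∈ S → i ≢ i' →
       ∀ j → j Sub.∈ σ i → j Sub.∈ σ i' → ⊥)
  × (∀ j → ∃[ i ] (i Sub.∈ S × j Sub.∈ σ i))

sumF : ∀ {n} → (Fin n → ℕ) → ℕ
sumF {n} a = sum (tabulate a)

-- A has a solution: the indices {1..3r} are partitioned into r triples
-- (g (j,0), g (j,1), g (j,2)), j < r, each triple summing to M.
HasThreePartition : (r M : ℕ) → (Fin (3 * r) → ℕ) → Set
HasThreePartition r M a =
  ∃[ g ] (Bijective {A = Fin r × Fin 3} {B = Fin (3 * r)} _≡_ _≡_ g
          × (∀ j → a (g (j , zero)) + a (g (j , suc zero)) + a (g (j , suc (suc zero))) ≡ M))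

-- vertices: u i (1 ≤ i ≤ 3r) and the chain w 0 , … , w r, where
-- w k = v_{k+1} for k < r and w r = D.
data Vtx (r : ℕ) : Set where
  u : Fin (3 * r) → Vtx r
  w : Fin (suc r) → Vtx r

D : ∀ {r} → Vtx r
D {r} = w (fromℕ r)

v : ∀ {r} → Fin r → Vtx r      -- v j = v_{j+1}
v j = w (inject₁ j)

-- edges: {u_i , v_1} and the chain edges {v_j , v_{j+1}}, {v_r , D}; all of length 1
data Edg (r : ℕ) : Set where
  uedge : Fin (3 * r) → Edg r
  cedge : Fin r → Edg r

edgEnds : ∀ {r} → Edg r → Vtx r × Vtx r
edgEnds (uedge i) = u i , w zero
edgEnds (cedge j) = w (inject₁ j) , w (suc j)

Gr : ℕ → Graph
Gr r = record { Vertex = Vtx r ; Edge = Edg r ; ends = edgEnds ; len = λ _ → 1 }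

chainWalk : (G : Graph) (n : ℕ) (f : Fin (suc n) → Vertex G) (g : Fin n → Edge G) →
            (∀ j → Joins G (g j) (f (inject₁ j)) (f (suc j))) →
            (p : Fin (suc n)) → Walk G (f p) (f (fromℕ n))
chainWalk G zero    f g h zero    = []
chainWalk G (suc n) f g h zero    =
  step (g zero) (h zero) (chainWalk G n (λ k → f (suc k)) (λ k → g (suc k)) (λ k → h (suc k)) zero)
chainWalk G (suc n) f g h (suc p) =
  chainWalk G n (λ k → f (suc k)) (λ k → g (suc k)) (λ k → h (suc k)) p

toD : ∀ r (p : Fin (suc r)) → Walk (Gr r) (w p) D
toD r = chainWalk (Gr r) r w cedge (λ j → inj₁ refl)

pathU : ∀ r (i : Fin (3 * r)) → Walk (Gr r) (u i) D
pathU r i = step (uedge i) (inj₁ refl) (toD r zero)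

pathV : ∀ r (j : Fin r) → Walk (Gr r) (v j) D
pathV r j = toD r (inject₁ j)

uTrip : ∀ r M (a : Fin (3 * r) → ℕ) (α β : ℕ) → Fin (3 * r) → Trip (Gr r)
uTrip r M a α β i = record
  { src = u i ; dst = D ; cap = a i * (r * M) ; detour = 0 ; stopLim = 1
  ; early = α ; late = β ; pref = pathU r i ∷ [] }

vTrip : ∀ r (α β : ℕ) → Fin r → Trip (Gr r)
vTrip r α β j = record
  { src = v j ; dst = D ; cap = 0 ; detour = 0 ; stopLim = 0
  ; early = α ; late = β ; pref = pathV r j ∷ [] }

-- trips are indexed by Fin (3r + r·(r M²)): first the 3r trips i, then for
-- each j < r a block of r M² trips with source v_j
construct : (r M : ℕ) (a : Fin (3 * r) → ℕ) (α β : ℕ) → Instance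
construct r M a α β = record
  { graph = Gr r
  ; N     = 3 * r + r * (r * M * M)
  ; trip  = λ k → [ uTrip r M a α β , (λ l → vTrip r α β (proj₁ (remQuot (r * M * M) l))) ]′
                    (splitAt (3 * r) k)
  }

module Submission where

-- (⇒, module Forward) Triple j is served at v_j: its members drive their
-- preferred paths from time α, and the member u_i picks up a_i · rM of the
-- rM² extra trips waiting at v_j; the drivers are exactly the 3r trips u_i.
-- (⇐, module Reverse) Every u_i drives (a detour-free route visits no other
-- u-vertex, and extra trips have capacity 0), stops at no more than one v_j,
-- and carries at most a_i · rM extra trips.  With fewer than rM self-driving
-- extra trips, the u-trips stopping at each v_j have total size ≥ M; as
-- Σ a_i = rM, every load is exactly M and every u_i stops somewhere, so the
-- stops form a 3-partition (blocks have three elements as M/4 < a_i < M/2).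

open import Data.Nat
open import Data.Nat.Properties
open import Data.Bool using (Bool; true; false; not; _∧_; if_then_else_) renaming (_≟_ to _≟ᵇ_)
open import Data.Fin as Fin using (Fin; zero; suc; _↑ˡ_; _↑ʳ_; combine; remQuot; splitAt; toℕ; inject₁)
import Data.Fin.Properties as Finₚ
open import Defs
open import Data.Fin.Subset as Sub using (Subset; ∣_∣)
open import Data.Vec as Vec using ([]; _∷_; lookup)
open import Data.Vec.Properties using ([]=⇒lookup; lookup⇒[]=; lookup∘tabulate)
open import Data.Product using (Σ; ∃; ∃-syntax; _×_; _,_; proj₁; proj₂)
open import Data.List as List using (List; []; _∷_; length; map; tabulate)
open import Data.List.Properties using (length-map; map-∘)
open import Data.List.Relation.Unary.Any as Any using (here; there)
open import Data.List.Relation.Unary.Any.Properties using (lookup-index)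
open import Data.List.Relation.Unary.All as All using ()
open import Data.List.Relation.Unary.AllPairs using ([]; _∷_)
open import Data.List.Relation.Unary.Unique.Propositional using (Unique)
import Data.List.Relation.Unary.Unique.Propositional.Properties as Uniqueₚ
open import Data.List.Membership.Propositional using (_∈_)
import Data.List.Membership.Propositional as L
open import Data.List.Membership.Propositional.Properties using (∈-map⁺; ∈-map⁻; ∈-lookup)
open import Data.Nat.ListAction using () renaming (sum to sumL)
open import Data.Sum using (_⊎_; inj₁; inj₂; [_,_]′)
open import Data.Empty using (⊥; ⊥-elim)
open import Relation.Nullary using (¬_; yes; no; Dec)
open import Relation.Nullary.Decidable using (does; dec-true; dec-false; does-⇔)
open import Function using (_∘_)
open import Function.Bundles using (mk⇔; _⇔_)
open import Function.Definitions using (Bijective; Injective; Surjective)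
open import Relation.Binary.PropositionalEquality
open import Algebra.Properties.Semiring.Sum +-*-semiring
  using (sum; sum-syntax; ∑-distrib-+; ∑-comm; *-distribˡ-sum; *-distribʳ-sum; sum-cong-≗; sum-replicate-zero)
open import Data.Nat.Solver using (module +-*-Solver)

witness : ∀ {p} {A : Set p} (d : Dec A) → does d ≡ true → A
witness (yes a) _ = a

refutation : ∀ {p} {A : Set p} (d : Dec A) → not (does d) ≡ true → ¬ A
refutation (no ¬a) _ = ¬a

not-true : ∀ {b} → ¬ (b ≡ true) → b ≡ false
not-true {true}  h = ⊥-elim (h refl)
not-true {false} h = refl

∑-const : ∀ n c → ∑[ i < n ] c ≡ n * c
∑-const zero    c = refl
∑-const (suc n) c = cong (c +_) (∑-const n c)

∑-zero : ∀ {n} (f : Fin n → ℕ) → (∀ i → f i ≡ 0) → sum f ≡ 0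
∑-zero {n} f h = trans (sum-cong-≗ h) (sum-replicate-zero n)

∑-mono : ∀ {n} {f g : Fin n → ℕ} → (∀ i → f i ≤ g i) → sum f ≤ sum g
∑-mono {zero}  h = z≤n
∑-mono {suc n} h = +-mono-≤ (h zero) (∑-mono (h ∘ suc))

term≤∑ : ∀ {n} (f : Fin n → ℕ) i → f i ≤ sum f
term≤∑ f zero    = m≤m+n _ _
term≤∑ f (suc i) = ≤-trans (term≤∑ (f ∘ suc) i) (m≤n+m _ _)

sumL-tabulate : ∀ {n} (f : Fin n → ℕ) → sumL (tabulate f) ≡ sum f
sumL-tabulate {zero}  f = refl
sumL-tabulate {suc n} f = cong (f zero +_) (sumL-tabulate (f ∘ suc))

∑-↑ : ∀ m {n} (f : Fin (m + n) → ℕ) →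
      sum f ≡ ∑[ i < m ] f (i ↑ˡ n) + ∑[ i < n ] f (m ↑ʳ i)
∑-↑ zero    f = refl
∑-↑ (suc m) f = trans (cong (f zero +_) (∑-↑ m (f ∘ suc))) (sym (+-assoc (f zero) _ _))

∑-combine : ∀ n K (f : Fin (n * K) → ℕ) →
            sum f ≡ ∑[ j < n ] ∑[ o < K ] f (combine j o)
∑-combine zero    K f = refl
∑-combine (suc n) K f =
  trans (∑-↑ K f) (cong (∑[ o < K ] f (o ↑ˡ (n * K)) +_) (∑-combine n K (λ i → f (K ↑ʳ i))))

∑-concentrated : ∀ {n} (f : Fin n → ℕ) j₀ → (∀ j → j ≢ j₀ → f j ≡ 0) → sum f ≤ f j₀
∑-concentrated f zero h =
  ≤-reflexive (trans (cong (f zero +_) (∑-zero (f ∘ suc) (λ j → h (suc j) (λ ())))) (+-identityʳ _))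
∑-concentrated f (suc j₀) h rewrite h zero (λ ()) =
  ∑-concentrated (f ∘ suc) j₀ (λ j j≢ → h (suc j) (j≢ ∘ Finₚ.suc-injective))

weighted≤ : ∀ {e} x → e ≤ 1 → e * x ≤ x
weighted≤ x e≤1 = ≤-trans (*-monoˡ-≤ x e≤1) (≤-reflexive (*-identityˡ x))

∑-avoiding : ∀ {n} (e f : Fin n → ℕ) → (∀ i → e i ≤ 1) → ∀ i₀ → e i₀ ≡ 0 →
             ∑[ i < n ] (e i * f i) + f i₀ ≤ sum f
∑-avoiding e f e≤1 zero e₀ rewrite e₀ =
  ≤-trans (≤-reflexive (+-comm (∑[ i < _ ] (e (suc i) * f (suc i))) (f zero)))
          (+-monoʳ-≤ (f zero) (∑-mono (λ i → weighted≤ (f (suc i)) (e≤1 (suc i)))))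
∑-avoiding e f e≤1 (suc i₀) e₀ =
  ≤-trans (≤-reflexive (+-assoc (e zero * f zero) _ (f (suc i₀))))
          (+-mono-≤ (weighted≤ (f zero) (e≤1 zero)) (∑-avoiding (e ∘ suc) (f ∘ suc) (e≤1 ∘ suc) i₀ e₀))

∑-excess : ∀ {n} (f g : Fin n → ℕ) → (∀ j → g j ≤ f j) → ∀ j₀ → sum g + (f j₀ ∸ g j₀) ≤ sum f
∑-excess f g g≤f zero = begin
  g zero + sum (g ∘ suc) + (f zero ∸ g zero)   ≡⟨ +-assoc (g zero) _ _ ⟩
  g zero + (sum (g ∘ suc) + (f zero ∸ g zero)) ≡⟨ cong (g zero +_) (+-comm (sum (g ∘ suc)) _) ⟩
  g zero + ((f zero ∸ g zero) + sum (g ∘ suc)) ≡⟨ sym (+-assoc (g zero) _ _) ⟩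
  g zero + (f zero ∸ g zero) + sum (g ∘ suc)   ≡⟨ cong (_+ sum (g ∘ suc)) (m+[n∸m]≡n (g≤f zero)) ⟩
  f zero + sum (g ∘ suc)                       ≤⟨ +-monoʳ-≤ (f zero) (∑-mono (g≤f ∘ suc)) ⟩
  f zero + sum (f ∘ suc)                       ∎
  where open ≤-Reasoning
∑-excess f g g≤f (suc j₀) =
  ≤-trans (≤-reflexive (+-assoc (g zero) _ _)) (+-mono-≤ (g≤f zero) (∑-excess (f ∘ suc) (g ∘ suc) (g≤f ∘ suc) j₀))

all-equal : ∀ {n} (s : Fin n → ℕ) M → (∀ j → M ≤ s j) → sum s ≤ n * M → ∀ j → s j ≡ M
all-equal {n} s M M≤s ∑≤ j = ≤-antisym (m∸n≡0⇒m≤n (n≤0⇒n≡0 excess≤0)) (M≤s j)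
  where
  excess≤0 : s j ∸ M ≤ 0
  excess≤0 = +-cancelˡ-≤ (n * M) _ _ (begin
    n * M + (s j ∸ M)           ≡⟨ cong (_+ (s j ∸ M)) (sym (∑-const n M)) ⟩
    ∑[ i < n ] M + (s j ∸ M)    ≤⟨ ∑-excess s (λ _ → M) M≤s j ⟩
    sum s                       ≤⟨ ∑≤ ⟩
    n * M                       ≡⟨ sym (+-identityʳ _) ⟩
    n * M + 0                   ∎)
    where open ≤-Reasoning

ind : Bool → ℕ
ind true  = 1
ind false = 0

count : ∀ {n} → (Fin n → Bool) → ℕ
count {n} P = ∑[ i < n ] ind (P i)

∣∣≡count : ∀ {n} (S : Subset n) → ∣ S ∣ ≡ count (lookup S)
∣∣≡count []          = refl
∣∣≡count (true  ∷ S) = cong suc (∣∣≡count S)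
∣∣≡count (false ∷ S) = ∣∣≡count S

count-all : ∀ {n} (P : Fin n → Bool) → (∀ i → P i ≡ true) → count P ≡ n
count-all {n} P h = trans (sum-cong-≗ (cong ind ∘ h)) (trans (∑-const n 1) (*-identityʳ n))

count-none : ∀ {n} (P : Fin n → Bool) → (∀ i → P i ≡ false) → count P ≡ 0
count-none P h = ∑-zero _ (cong ind ∘ h)

count-mono : ∀ {n} (P Q : Fin n → Bool) → (∀ i → P i ≡ true → Q i ≡ true) → count P ≤ count Q
count-mono P Q P⊆Q = ∑-mono pointwise
  where
  pointwise : ∀ i → ind (P i) ≤ ind (Q i)
  pointwise i with P i in eq
  ... | false = z≤n
  ... | true rewrite P⊆Q i eq = ≤-refl

count-compl : ∀ {n} (P : Fin n → Bool) → count P + count (not ∘ P) ≡ n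
count-compl {n} P =
  trans (sym (∑-distrib-+ (ind ∘ P) (ind ∘ not ∘ P)))
        (trans (sum-cong-≗ pointwise) (trans (∑-const n 1) (*-identityʳ n)))
  where
  pointwise : ∀ i → ind (P i) + ind (not (P i)) ≡ 1
  pointwise i with P i
  ... | true  = refl
  ... | false = refl

count-pos : ∀ {n} (P : Fin n → Bool) i → P i ≡ true → 1 ≤ count P
count-pos P i h = ≤-trans (≤-reflexive (cong ind (sym h))) (term≤∑ (ind ∘ P) i)

two≤count : ∀ {n} (P : Fin n → Bool) x y → x ≢ y → P x ≡ true → P y ≡ true → 2 ≤ count P
two≤count P zero    zero    x≢y _  _  = ⊥-elim (x≢y refl)
two≤count P zero    (suc y) _   px py rewrite px = s≤s (count-pos (P ∘ suc) y py)
two≤count P (suc x) zero    _   px py rewrite py = s≤s (count-pos (P ∘ suc) x px)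
two≤count P (suc x) (suc y) x≢y px py =
  ≤-trans (two≤count (P ∘ suc) x y (x≢y ∘ cong suc) px py) (m≤n+m _ _)

count≤1 : ∀ {n} (P : Fin n → Bool) → (∀ x y → P x ≡ true → P y ≡ true → x ≡ y) → count P ≤ 1
count≤1 {zero}  P uniq = z≤n
count≤1 {suc n} P uniq with P zero in eq
... | false = count≤1 (P ∘ suc) (λ x y px py → Finₚ.suc-injective (uniq (suc x) (suc y) px py))
... | true  = ≤-reflexive (cong suc (count-none (P ∘ suc) rest))
  where
  rest : ∀ i → P (suc i) ≡ false
  rest i = not-true (λ h → Finₚ.0≢1+n (uniq zero (suc i) eq h))

count-union : ∀ {n m} (P : Fin n → Bool) (Q : Fin m → Fin n → Bool) →
              (∀ o → P o ≡ true → ∃[ i ] Q i o ≡ true) →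
              count P ≤ ∑[ i < m ] count (Q i)
count-union P Q cover = ≤-trans (∑-mono pointwise) (≤-reflexive (∑-comm (λ o i → ind (Q i o))))
  where
  pointwise : ∀ o → ind (P o) ≤ ∑[ i < _ ] ind (Q i o)
  pointwise o with P o in eq
  ... | false = z≤n
  ... | true with cover o eq
  ... | i , q = ≤-trans (≤-reflexive (sym (cong ind q))) (term≤∑ (λ i → ind (Q i o)) i)

count-below : ∀ K x → count {K} (λ o → does (toℕ o <? x)) ≡ K ⊓ x
count-below zero    x       = refl
count-below (suc K) zero    = count-none {suc K} (λ o → does (toℕ o <? 0)) (λ o → dec-false (toℕ o <? 0) λ ())
count-below (suc K) (suc x) = cong suc (trans (sum-cong-≗ {K} (cong ind ∘ shift ∘ toℕ)) (count-below K x))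
  where
  shift : ∀ m → does (suc m <? suc x) ≡ does (m <? x)
  shift m = does-⇔ (mk⇔ s<s⁻¹ s<s) (suc m <? suc x) (m <? x)

count-interval : ∀ K lo hi → lo ≤ K → lo ≤ hi →
                 count {K} (λ o → does (lo ≤? toℕ o) ∧ does (toℕ o <? hi)) ≤ hi ∸ lo
count-interval K lo hi lo≤K lo≤hi = m+n≤o⇒m≤o∸n _ (≤-trans (≤-reflexive split) (m⊓n≤n K hi))
  where
  In : Fin K → Bool
  In o = does (lo ≤? toℕ o) ∧ does (toℕ o <? hi)
  -- [0 , hi) is the disjoint union of [lo , hi) and [0 , lo)
  pointwise : ∀ n → ind (does (lo ≤? n) ∧ does (n <? hi)) + ind (does (n <? lo)) ≡ ind (does (n <? hi))
  pointwise n with n <? lo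
  ... | yes n<lo rewrite dec-true (n <? lo) n<lo | dec-false (lo ≤? n) (<⇒≱ n<lo)
                       | dec-true (n <? hi) (<-≤-trans n<lo lo≤hi) = refl
  ... | no  n≮lo rewrite dec-false (n <? lo) n≮lo | dec-true (lo ≤? n) (≮⇒≥ n≮lo) = +-identityʳ _
  split : count In + lo ≡ K ⊓ hi
  split = begin
    count In + lo                                      ≡⟨ cong (count In +_) (sym (m≥n⇒m⊓n≡n lo≤K)) ⟩
    count In + K ⊓ lo                                  ≡⟨ cong (count In +_) (sym (count-below K lo)) ⟩
    count In + count {K} (λ o → does (toℕ o <? lo))    ≡⟨ sym (∑-distrib-+ {K} (ind ∘ In) _) ⟩
    ∑[ o < K ] (ind (In o) + ind (does (toℕ o <? lo))) ≡⟨ sum-cong-≗ {K} (pointwise ∘ toℕ) ⟩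
    count {K} (λ o → does (toℕ o <? hi))               ≡⟨ count-below K hi ⟩
    K ⊓ hi                                             ∎
    where open ≡-Reasoning

third : ℕ → ℕ → ℕ → Fin 3
third x₀ x₁ n = if does (n <? x₀) then zero else if does (n <? x₀ + x₁) then suc zero else suc (suc zero)

piece-start : ℕ → ℕ → Fin 3 → ℕ
piece-start x₀ x₁ zero             = 0
piece-start x₀ x₁ (suc zero)       = x₀
piece-start x₀ x₁ (suc (suc zero)) = x₀ + x₁

piece-size : ℕ → ℕ → ℕ → Fin 3 → ℕ
piece-size x₀ x₁ x₂ zero             = x₀
piece-size x₀ x₁ x₂ (suc zero)       = x₁
piece-size x₀ x₁ x₂ (suc (suc zero)) = x₂

third-start : ∀ x₀ x₁ n → piece-start x₀ x₁ (third x₀ x₁ n) ≤ n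
third-start x₀ x₁ n with n <? x₀
... | yes n<x₀ rewrite dec-true (n <? x₀) n<x₀ = z≤n
... | no  n≮x₀ rewrite dec-false (n <? x₀) n≮x₀ with n <? x₀ + x₁
...   | yes n<x₀₁ rewrite dec-true (n <? x₀ + x₁) n<x₀₁ = ≮⇒≥ n≮x₀
...   | no  n≮x₀₁ rewrite dec-false (n <? x₀ + x₁) n≮x₀₁ = ≮⇒≥ n≮x₀₁

third-end : ∀ x₀ x₁ x₂ n → n < x₀ + x₁ + x₂ →
            n < piece-start x₀ x₁ (third x₀ x₁ n) + piece-size x₀ x₁ x₂ (third x₀ x₁ n)
third-end x₀ x₁ x₂ n n<end with n <? x₀
... | yes n<x₀ rewrite dec-true (n <? x₀) n<x₀ = n<x₀
... | no  n≮x₀ rewrite dec-false (n <? x₀) n≮x₀ with n <? x₀ + x₁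
...   | yes n<x₀₁ rewrite dec-true (n <? x₀ + x₁) n<x₀₁ = n<x₀₁
...   | no  n≮x₀₁ rewrite dec-false (n <? x₀ + x₁) n≮x₀₁ = n<end

third-count : ∀ x₀ x₁ x₂ K → x₀ + x₁ + x₂ ≡ K → ∀ c →
              count {K} (λ o → does (third x₀ x₁ (toℕ o) Finₚ.≟ c)) ≤ piece-size x₀ x₁ x₂ c
third-count x₀ x₁ x₂ K total c = begin
  count {K} (λ o → does (third x₀ x₁ (toℕ o) Finₚ.≟ c)) ≤⟨ count-mono _ In in-piece ⟩
  count In                                             ≤⟨ count-interval K lo (lo + size) lo≤K (m≤m+n lo size) ⟩
  lo + size ∸ lo                                       ≡⟨ m+n∸m≡n lo size ⟩
  size                                                 ∎
  where
  open ≤-Reasoning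
  lo   = piece-start x₀ x₁ c
  size = piece-size x₀ x₁ x₂ c
  In : Fin K → Bool
  In o = does (lo ≤? toℕ o) ∧ does (toℕ o <? lo + size)
  in-piece : ∀ o → does (third x₀ x₁ (toℕ o) Finₚ.≟ c) ≡ true → In o ≡ true
  in-piece o is-c with witness (third x₀ x₁ (toℕ o) Finₚ.≟ c) is-c
  ... | refl rewrite dec-true (lo ≤? toℕ o) (third-start x₀ x₁ (toℕ o))
                   | dec-true (toℕ o <? lo + size)
                       (third-end x₀ x₁ x₂ (toℕ o) (subst (toℕ o <_) (sym total) (Finₚ.toℕ<n o))) = refl
  lo≤K : lo ≤ K
  lo≤K = ≤-trans (start≤ c) (≤-reflexive total)
    where
    start≤ : ∀ c → piece-start x₀ x₁ c ≤ x₀ + x₁ + x₂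
    start≤ zero             = z≤n
    start≤ (suc zero)       = ≤-trans (m≤m+n x₀ x₁) (m≤m+n _ x₂)
    start≤ (suc (suc zero)) = m≤m+n _ x₂

-- The size constraint of 3-partition: if every a i lies strictly between
-- M/4 and M/2, then any set whose a-values sum to M has exactly three
-- elements (two are too few, four too many).
three-elements : ∀ {n} (P : Fin n → Bool) (a : Fin n → ℕ) M →
                 (∀ i → M < 4 * a i × 2 * a i < M) → 0 < M →
                 ∑[ i < n ] (ind (P i) * a i) ≡ M → count P ≡ 3
three-elements {n} P a M bounds M>0 ∑≡M = ≤-antisym at-most-three at-least-three
  where
  open +-*-Solver
  c = count P
  scale4 : ∀ e x → e * (4 * x) ≡ 4 * (e * x)
  scale4 = solve 2 (λ e x → e :* (con 4 :* x) := con 4 :* (e :* x)) refl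
  scale2+1 : ∀ e x → e * (2 * x + 1) ≡ 2 * (e * x) + e
  scale2+1 = solve 2 (λ e x → e :* (con 2 :* x :+ con 1) := con 2 :* (e :* x) :+ e) refl
  -- each chosen a i exceeds M / 4
  upper : c * suc M ≤ 4 * M
  upper = begin
    c * suc M                                    ≡⟨ *-distribʳ-sum (suc M) (ind ∘ P) ⟩
    ∑[ i < n ] (ind (P i) * suc M)               ≤⟨ ∑-mono (λ i → *-monoʳ-≤ (ind (P i)) (proj₁ (bounds i))) ⟩
    ∑[ i < n ] (ind (P i) * (4 * a i))           ≡⟨ sum-cong-≗ {n} (λ i → scale4 (ind (P i)) (a i)) ⟩
    ∑[ i < n ] (4 * (ind (P i) * a i))           ≡⟨ sym (*-distribˡ-sum 4 (λ i → ind (P i) * a i)) ⟩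
    4 * ∑[ i < n ] (ind (P i) * a i)             ≡⟨ cong (4 *_) ∑≡M ⟩
    4 * M                                        ∎
    where open ≤-Reasoning
  -- each chosen a i is below M / 2
  lower : 2 * M + c ≤ c * M
  lower = begin
    2 * M + c                                    ≡⟨ cong (λ x → 2 * x + c) (sym ∑≡M) ⟩
    2 * ∑[ i < n ] (ind (P i) * a i) + c         ≡⟨ cong (_+ c) (*-distribˡ-sum 2 (λ i → ind (P i) * a i)) ⟩
    ∑[ i < n ] (2 * (ind (P i) * a i)) + c       ≡⟨ sym (∑-distrib-+ (λ i → 2 * (ind (P i) * a i)) (ind ∘ P)) ⟩
    ∑[ i < n ] (2 * (ind (P i) * a i) + ind (P i)) ≡⟨ sum-cong-≗ {n} (λ i → sym (scale2+1 (ind (P i)) (a i))) ⟩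
    ∑[ i < n ] (ind (P i) * (2 * a i + 1))       ≤⟨ ∑-mono (λ i → *-monoʳ-≤ (ind (P i)) (2a+1≤M i)) ⟩
    ∑[ i < n ] (ind (P i) * M)                   ≡⟨ sym (*-distribʳ-sum M (ind ∘ P)) ⟩
    c * M                                        ∎
    where
    open ≤-Reasoning
    2a+1≤M : ∀ i → 2 * a i + 1 ≤ M
    2a+1≤M i = ≤-trans (≤-reflexive (+-comm (2 * a i) 1)) (proj₂ (bounds i))
  at-most-three : c ≤ 3
  at-most-three = ≤-pred (*-cancelʳ-< (suc M) c 4 (≤-<-trans upper 4M<4[1+M]))
    where
    4M<4[1+M] : 4 * M < 4 * suc M
    4M<4[1+M] = subst (4 * M <_) (sym (*-suc 4 M)) (m<n+m (4 * M) {4} z<s)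
  at-least-three : 3 ≤ c
  at-least-three = ≮⇒≥ λ c<3 → <⇒≱ M>0 (M≤0 (c≡0 (≤-pred c<3)))
    where
    c≡0 : c ≤ 2 → c ≡ 0
    c≡0 c≤2 = n≤0⇒n≡0 (+-cancelˡ-≤ (2 * M) c 0
                (≤-trans lower (≤-trans (*-monoˡ-≤ M c≤2) (≤-reflexive (sym (+-identityʳ (2 * M)))))))
    M≤0 : c ≡ 0 → M ≤ 0
    M≤0 c≡0 = ≤-trans (m≤m+n M (M + 0)) (≤-trans (m≤m+n (2 * M) c) (≤-trans lower (≤-reflexive (cong (_* M) c≡0))))

members : ∀ {n} → (Fin n → Bool) → List (Fin n)
members {zero}  P = []
members {suc n} P = if P zero then zero ∷ later else later
  where later = map suc (members (P ∘ suc))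

length-members : ∀ {n} (P : Fin n → Bool) → length (members P) ≡ count P
length-members {zero}  P = refl
length-members {suc n} P with P zero
... | true  = cong suc (trans (length-map suc (members (P ∘ suc))) (length-members (P ∘ suc)))
... | false = trans (length-map suc (members (P ∘ suc))) (length-members (P ∘ suc))

sum-members : ∀ {n} (P : Fin n → Bool) (a : Fin n → ℕ) →
              sumL (map a (members P)) ≡ ∑[ i < n ] (ind (P i) * a i)
sum-later : ∀ {n} (P : Fin (suc n) → Bool) (a : Fin (suc n) → ℕ) →
            sumL (map a (map suc (members (P ∘ suc)))) ≡ ∑[ i < n ] (ind (P (suc i)) * a (suc i))

sum-members {zero}  P a = refl
sum-members {suc n} P a with P zero
... | true  = cong₂ _+_ (sym (+-identityʳ (a zero))) (sum-later P a)
... | false = sum-later P a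

sum-later P a = trans (cong sumL (sym (map-∘ (members (P ∘ suc))))) (sum-members (P ∘ suc) (a ∘ suc))

∈-members⁺ : ∀ {n} (P : Fin n → Bool) i → P i ≡ true → i ∈ members P
∈-members⁺ {suc n} P zero    h rewrite h = here refl
∈-members⁺ {suc n} P (suc i) h with P zero
... | true  = there (∈-map⁺ suc (∈-members⁺ (P ∘ suc) i h))
... | false = ∈-map⁺ suc (∈-members⁺ (P ∘ suc) i h)

∈-members⁻ : ∀ {n} (P : Fin n → Bool) i → i ∈ members P → P i ≡ true
∈-later⁻ : ∀ {n} (P : Fin (suc n) → Bool) i → i ∈ map suc (members (P ∘ suc)) → P i ≡ true

∈-members⁻ {suc n} P i i∈ with P zero in eq
... | false = ∈-later⁻ P i i∈
... | true with i∈
...   | here refl = eq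
...   | there i∈′ = ∈-later⁻ P i i∈′

∈-later⁻ P i i∈ with ∈-map⁻ suc i∈
... | j , j∈ , refl = ∈-members⁻ (P ∘ suc) j j∈

members-unique : ∀ {n} (P : Fin n → Bool) → Unique (members P)
members-unique {zero}  P = []
members-unique {suc n} P with P zero
... | true  = All.tabulate zero∉later ∷ later-unique
  where
  later-unique = Uniqueₚ.map⁺ Finₚ.suc-injective (members-unique (P ∘ suc))
  zero∉later : ∀ {x} → x ∈ map suc (members (P ∘ suc)) → zero ≢ x
  zero∉later x∈ with ∈-map⁻ suc x∈
  ... | _ , _ , refl = λ ()
... | false = Uniqueₚ.map⁺ Finₚ.suc-injective (members-unique (P ∘ suc))

lookup-injective : ∀ {A : Set} {xs : List A} → Unique xs →
                   ∀ {i j} → List.lookup xs i ≡ List.lookup xs j → i ≡ j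
lookup-injective (_  ∷ _) {zero}  {zero}  _ = refl
lookup-injective (x∉ ∷ _) {zero}  {suc j} e = ⊥-elim (All.lookup x∉ (∈-lookup j) e)
lookup-injective (x∉ ∷ _) {suc i} {zero}  e = ⊥-elim (All.lookup x∉ (∈-lookup i) (sym e))
lookup-injective (_  ∷ rest) {suc i} {suc j} e = cong suc (lookup-injective rest e)

list₃ : ∀ {A : Set} → A × A × A → List A
list₃ (x , y , z) = x ∷ y ∷ z ∷ []

as-triple : ∀ {A : Set} (l : List A) → length l ≡ 3 → ∃[ t ] l ≡ list₃ t
as-triple (x ∷ y ∷ z ∷ []) refl = (x , y , z) , refl

≤1-member : ∀ {A : Set} {x y : A} (xs : List A) → length xs ≤ 1 → x ∈ xs → y ∈ xs → x ≡ y
≤1-member (_ ∷ [])     _ (here refl) (here refl) = refl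
≤1-member (_ ∷ _ ∷ _) (s≤s ())

fibre : ∀ {m r} → (Fin m → Fin r) → Fin r → Fin m → Bool
fibre blk j i = does (blk i Finₚ.≟ j)

enumerate-fibres : ∀ {m r} (blk : Fin m → Fin r) → (∀ j → count (fibre blk j) ≡ 3) →
  ∃[ g ] (Bijective {A = Fin r × Fin 3} _≡_ _≡_ g
          × ∀ j → members (fibre blk j) ≡ g (j , zero) ∷ g (j , suc zero) ∷ g (j , suc (suc zero)) ∷ [])
enumerate-fibres {m} {r} blk size3 = g , (g-injective , g-surjective) , λ j → proj₂ (row j)
  where
  row : ∀ j → ∃[ t ] members (fibre blk j) ≡ list₃ t
  row j = as-triple (members (fibre blk j)) (trans (length-members (fibre blk j)) (size3 j))
  g : Fin r × Fin 3 → Fin m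
  g (j , c) = List.lookup (list₃ (proj₁ (row j))) c
  row-unique : ∀ j → Unique (list₃ (proj₁ (row j)))
  row-unique j = subst Unique (proj₂ (row j)) (members-unique (fibre blk j))
  blk∘g : ∀ j c → blk (g (j , c)) ≡ j
  blk∘g j c = witness (blk (g (j , c)) Finₚ.≟ j)
    (∈-members⁻ (fibre blk j) _ (subst (g (j , c) ∈_) (sym (proj₂ (row j))) (∈-lookup c)))
  g-injective : Injective _≡_ _≡_ g
  g-injective {j , c} {j′ , c′} e with trans (sym (blk∘g j c)) (trans (cong blk e) (blk∘g j′ c′))
  ... | refl = cong (j ,_) (lookup-injective (row-unique j) e)
  g-surjective : Surjective _≡_ _≡_ g
  g-surjective i = (blk i , Any.index i∈row) , λ { refl → sym (lookup-index i∈row) }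
    where
    i∈row : i ∈ list₃ (proj₁ (row (blk i)))
    i∈row = subst (i ∈_) (proj₂ (row (blk i))) (∈-members⁺ (fibre blk (blk i)) i (dec-true (blk i Finₚ.≟ blk i) refl))

partition-from-blocks : ∀ r M (a : Fin (3 * r) → ℕ) →
  (∀ i → M < 4 * a i × 2 * a i < M) → 0 < M → (blk : Fin (3 * r) → Fin r) →
  (∀ j → ∑[ i < 3 * r ] (ind (fibre blk j i) * a i) ≡ M) → HasThreePartition r M a
partition-from-blocks r M a bounds M>0 blk block-sum = g , g-bijective , row-sum
  where
  enumeration = enumerate-fibres blk (λ j → three-elements (fibre blk j) a M bounds M>0 (block-sum j))
  g = proj₁ enumeration
  g-bijective = proj₁ (proj₂ enumeration)
  row-sum : ∀ j → a (g (j , zero)) + a (g (j , suc zero)) + a (g (j , suc (suc zero))) ≡ M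
  row-sum j = begin
    a (g (j , zero)) + a (g (j , suc zero)) + a (g (j , suc (suc zero)))
      ≡⟨ +-assoc (a (g (j , zero))) _ _ ⟩
    a (g (j , zero)) + (a (g (j , suc zero)) + a (g (j , suc (suc zero))))
      ≡⟨ cong (λ x → a (g (j , zero)) + (a (g (j , suc zero)) + x)) (sym (+-identityʳ _)) ⟩
    sumL (map a (g (j , zero) ∷ g (j , suc zero) ∷ g (j , suc (suc zero)) ∷ []))
      ≡⟨ cong (sumL ∘ map a) (sym (proj₂ (proj₂ enumeration) j)) ⟩
    sumL (map a (members (fibre blk j)))
      ≡⟨ sum-members (fibre blk j) a ⟩
    ∑[ i < 3 * r ] (ind (fibre blk j i) * a i)
      ≡⟨ block-sum j ⟩
    M ∎
    where open ≡-Reasoning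

module _ (G : Graph) (unit : ∀ e → len G e ≡ 1) where

  chain-length : ∀ n f g h → lengthW (chainWalk G n f g h zero) ≡ n
  chain-length zero    f g h = refl
  chain-length (suc n) f g h =
    cong₂ _+_ (unit (g zero)) (chain-length n (f ∘ suc) (g ∘ suc) (h ∘ suc))

  chain-visits : ∀ n f g h (p : Fin (suc n)) →
    Σ (Fin (suc (steps (chainWalk G n f g h zero)))) λ q →
      vertAt (chainWalk G n f g h zero) q ≡ f p × toℕ q ≡ toℕ p
      × distAt (chainWalk G n f g h zero) q ≡ toℕ p
  chain-visits zero    f g h zero    = zero , refl , refl , refl
  chain-visits (suc n) f g h zero    = zero , refl , refl , refl
  chain-visits (suc n) f g h (suc p) with chain-visits n (f ∘ suc) (g ∘ suc) (h ∘ suc) p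
  ... | q , at , index , dist = suc q , at , cong suc index , cong₂ _+_ (unit (g zero)) dist

-- A potential d on pairs of vertices that changes by at most the edge
-- length along every edge bounds travel distances from below: on a walk W from x to y, the distance covered
-- up to the p-th vertex is at least d x (vertAt W p), and the rest of the
-- walk is at least d (vertAt W p) y long.
module Potential (G : Graph) (d : Vertex G → Vertex G → ℕ)
  (d-refl : ∀ x → d x x ≡ 0)
  (d-edge : ∀ e x y → Joins G e x y → ∀ z → d x z ≤ len G e + d y z) where

  length≥d : ∀ {x y} (W : Walk G x y) → d x y ≤ lengthW W
  length≥d {x} []             = ≤-reflexive (d-refl x)
  length≥d {y = y} (step e j W) = ≤-trans (d-edge e _ _ j y) (+-monoʳ-≤ (len G e) (length≥d W))

  prefix≥d : ∀ {x y} (W : Walk G x y) p → d x (vertAt W p) ≤ distAt W p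
  prefix≥d {x} []           zero    = ≤-reflexive (d-refl x)
  prefix≥d {x} (step e j W) zero    = ≤-reflexive (d-refl x)
  prefix≥d     (step e j W) (suc p) = ≤-trans (d-edge e _ _ j _) (+-monoʳ-≤ (len G e) (prefix≥d W p))

  suffix≥d : ∀ {x y} (W : Walk G x y) p → distAt W p + d (vertAt W p) y ≤ lengthW W
  suffix≥d {x} []           zero    = ≤-reflexive (d-refl x)
  suffix≥d     (step e j W) zero    = length≥d (step e j W)
  suffix≥d     (step e j W) (suc p) =
    ≤-trans (≤-reflexive (+-assoc (len G e) _ _)) (+-monoʳ-≤ (len G e) (suffix≥d W p))

module _ (r : ℕ) where

  -- the graph distance: the u-vertices hang off w 0 = v₁, and w p is p
  -- steps down the chain w 0 , … , w r = D
  dist : Vtx r → Vtx r → ℕ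
  dist (u i) (u i′) = if does (i Finₚ.≟ i′) then 0 else 2
  dist (u i) (w p)  = suc (toℕ p)
  dist (w p) (u i)  = suc (toℕ p)
  dist (w p) (w q)  = ∣ toℕ p - toℕ q ∣

  dist-refl : ∀ x → dist x x ≡ 0
  dist-refl (u i) rewrite dec-true (i Finₚ.≟ i) refl = refl
  dist-refl (w p) = ∣n-n∣≡0 (toℕ p)

  private
    dist-uu≤2 : ∀ i i′ → dist (u i) (u i′) ≤ 2
    dist-uu≤2 i i′ with does (i Finₚ.≟ i′)
    ... | true  = z≤n
    ... | false = ≤-refl

    ∣n-1+n∣≡1 : ∀ n → ∣ n - suc n ∣ ≡ 1
    ∣n-1+n∣≡1 n = trans (cong (∣ n -_∣) (+-comm 1 n)) (∣m-m+n∣≡n n 1)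

    ∣1+n-n∣≡1 : ∀ n → ∣ suc n - n ∣ ≡ 1
    ∣1+n-n∣≡1 n = trans (∣-∣-comm (suc n) n) (∣n-1+n∣≡1 n)

  dist-edge : ∀ e x y → Joins (Gr r) e x y → ∀ z → dist x z ≤ len (Gr r) e + dist y z
  dist-edge (uedge k) _ _ (inj₁ refl) (u k′) = dist-uu≤2 k k′
  dist-edge (uedge k) _ _ (inj₁ refl) (w q)  = ≤-refl
  dist-edge (uedge k) _ _ (inj₂ refl) (u k′) = s≤s z≤n
  dist-edge (uedge k) _ _ (inj₂ refl) (w q)  = ≤-trans (n≤1+n _) (n≤1+n _)
  dist-edge (cedge j) _ _ (inj₁ refl) (u k) rewrite Finₚ.toℕ-inject₁ j = ≤-trans (n≤1+n _) (n≤1+n _)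
  dist-edge (cedge j) _ _ (inj₁ refl) (w q) rewrite Finₚ.toℕ-inject₁ j =
    ≤-trans (∣-∣-triangle (toℕ j) (suc (toℕ j)) (toℕ q))
            (≤-reflexive (cong (_+ ∣ suc (toℕ j) - toℕ q ∣) (∣n-1+n∣≡1 (toℕ j))))
  dist-edge (cedge j) _ _ (inj₂ refl) (u k) rewrite Finₚ.toℕ-inject₁ j = ≤-refl
  dist-edge (cedge j) _ _ (inj₂ refl) (w q) rewrite Finₚ.toℕ-inject₁ j =
    ≤-trans (∣-∣-triangle (suc (toℕ j)) (toℕ j) (toℕ q))
            (≤-reflexive (cong (_+ ∣ toℕ j - toℕ q ∣) (∣1+n-n∣≡1 (toℕ j))))

  open Potential (Gr r) dist dist-refl dist-edge

  v-injective : ∀ {j j′ : Fin r} → v j ≡ v j′ → j ≡ j′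
  v-injective {j} {j′} e = Finₚ.inject₁-injective (w-injective e)
    where
    w-injective : ∀ {p q} → w {r} p ≡ w q → p ≡ q
    w-injective refl = refl

  -- A walk from u i′ to D that is no longer than the preferred path (r + 1)
  -- visits no u-vertex other than u i′: the detour to u i and then on to D
  -- alone costs 2 + (r + 1).
  visits-only-own-u : ∀ i i′ (W : Walk (Gr r) (u i′) D) → lengthW W ≤ suc r →
                      ∀ p → vertAt W p ≡ u i → i ≡ i′
  visits-only-own-u i i′ W short p at with i Finₚ.≟ i′
  ... | yes i≡i′ = i≡i′
  ... | no  i≢i′ = ⊥-elim (<⇒≱ too-long short)
    where
    to-u : 2 ≤ distAt W p
    to-u = subst (λ x → x ≤ distAt W p)
                 (trans (cong (dist (u i′)) at) (cong (if_then 0 else 2) (dec-false (i′ Finₚ.≟ i) (i≢i′ ∘ sym))))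
                 (prefix≥d W p)
    u-to-D : dist (vertAt W p) D ≡ suc r
    u-to-D = trans (cong (λ x → dist x D) at) (cong suc (Finₚ.toℕ-fromℕ r))
    too-long : suc r < lengthW W
    too-long = ≤-trans (n≤1+n _)
                 (≤-trans (+-mono-≤ to-u (≤-reflexive (sym u-to-D))) (suffix≥d W p))

module Indexing (r M : ℕ) (a : Fin (3 * r) → ℕ) (α β : ℕ) where

  I : Instance
  I = construct r M a α β

  -- the capacity unit: u_i has a i · B seats
  B : ℕ
  B = r * M

  K : ℕ
  K = r * M * M

  uI : Fin (3 * r) → Fin (N I)
  uI i = i ↑ˡ (r * K)

  vI : Fin r → Fin K → Fin (N I)
  vI j o = (3 * r) ↑ʳ combine j o

  trip-u : ∀ i → trip I (uI i) ≡ uTrip r M a α β i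
  trip-u i rewrite Finₚ.splitAt-↑ˡ (3 * r) i (r * K) = refl

  trip-v : ∀ j o → trip I (vI j o) ≡ vTrip r α β j
  trip-v j o rewrite Finₚ.splitAt-↑ʳ (3 * r) (r * K) (combine j o) =
    cong (vTrip r α β ∘ proj₁) (Finₚ.remQuot-combine {r} {K} j o)

  kind : ∀ k → (∃[ i ] k ≡ uI i) ⊎ (∃[ j ] ∃[ o ] k ≡ vI j o)
  kind k with splitAt (3 * r) k in eq
  ... | inj₁ i = inj₁ (i , trans (sym (Finₚ.join-splitAt (3 * r) (r * K) k))
                                  (cong [ _↑ˡ (r * K) , (3 * r) ↑ʳ_ ]′ eq))
  ... | inj₂ l = inj₂ (proj₁ (remQuot {r} K l) , proj₂ (remQuot {r} K l) ,
                   trans (sym (Finₚ.join-splitAt (3 * r) (r * K) k))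
                     (trans (cong [ _↑ˡ (r * K) , (3 * r) ↑ʳ_ ]′ eq)
                            (cong ((3 * r) ↑ʳ_) (sym (Finₚ.combine-remQuot {r} K l)))))

  uI≢vI : ∀ i j o → uI i ≢ vI j o
  uI≢vI i j o e with trans (sym (Finₚ.splitAt-↑ˡ (3 * r) i (r * K)))
                      (trans (cong (splitAt (3 * r)) e) (Finₚ.splitAt-↑ʳ (3 * r) (r * K) (combine j o)))
  ... | ()

  uI-injective : ∀ {i i′} → uI i ≡ uI i′ → i ≡ i′
  uI-injective {i} {i′} = Finₚ.↑ˡ-injective (r * K) i i′

  ∑-trips : (f : Fin (N I) → ℕ) →
            sum f ≡ ∑[ i < 3 * r ] f (uI i) + ∑[ j < r ] ∑[ o < K ] f (vI j o)
  ∑-trips f = trans (∑-↑ (3 * r) f) (cong (∑[ i < 3 * r ] f (uI i) +_) (∑-combine r K (λ l → f ((3 * r) ↑ʳ l))))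

  pathU-length : ∀ i → lengthW (pathU r i) ≡ suc r
  pathU-length i = cong suc (chain-length (Gr r) (λ _ → refl) r w cedge (λ j → inj₁ refl))

module Forward (r M : ℕ) (a : Fin (3 * r) → ℕ) (α β : ℕ) (on-time : α + (r + 1) ≤ β)
  (g : Fin r × Fin 3 → Fin (3 * r))
  (g-bijective : Bijective {A = Fin r × Fin 3} {B = Fin (3 * r)} _≡_ _≡_ g)
  (row-sum : ∀ j → a (g (j , zero)) + a (g (j , suc zero)) + a (g (j , suc (suc zero))) ≡ M) where
  open Indexing r M a α β

  -- triple j of the partition is served at v_j; (block i , position i) is
  -- the place of u_i in the partition
  place : Fin (3 * r) → Fin r × Fin 3
  place i = proj₁ (proj₂ g-bijective i)

  g∘place : ∀ i → g (place i) ≡ i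
  g∘place i = proj₂ (proj₂ g-bijective i) refl

  -- the extra trips at v_j are shared among the triple: its c-th member
  -- takes seats j c = a (g (j , c)) · B of them, and these add up to K
  seats : Fin r → Fin 3 → ℕ
  seats j c = a (g (j , c)) * B

  seats-total : ∀ j → seats j zero + seats j (suc zero) + seats j (suc (suc zero)) ≡ K
  seats-total j = begin
    seats j zero + seats j (suc zero) + seats j (suc (suc zero))
      ≡⟨ cong (_+ seats j (suc (suc zero))) (sym (*-distribʳ-+ B (a (g (j , zero))) _)) ⟩
    (a (g (j , zero)) + a (g (j , suc zero))) * B + seats j (suc (suc zero))
      ≡⟨ sym (*-distribʳ-+ B (a (g (j , zero)) + a (g (j , suc zero))) _) ⟩
    (a (g (j , zero)) + a (g (j , suc zero)) + a (g (j , suc (suc zero)))) * B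
      ≡⟨ cong (_* B) (row-sum j) ⟩
    M * B
      ≡⟨ *-comm M B ⟩
    K ∎
    where open ≡-Reasoning

  assigned : Fin r → Fin K → Fin 3
  assigned j o = third (seats j zero) (seats j (suc zero)) (toℕ o)

  assigned-count : ∀ j c → count (λ o → does (assigned j o Finₚ.≟ c)) ≤ seats j c
  assigned-count j c = ≤-trans (third-count _ _ _ K (seats-total j) c) (≤-reflexive (size c))
    where
    size : ∀ c → piece-size (seats j zero) (seats j (suc zero)) (seats j (suc (suc zero))) c ≡ seats j c
    size zero             = refl
    size (suc zero)       = refl
    size (suc (suc zero)) = refl

  carrier : Fin r × Fin K → Fin (N I)
  carrier (j , o) = uI (g (j , assigned j o))

  ride : Fin (N I) → Fin (N I)
  ride k = [ uI , carrier ∘ remQuot {r} K ]′ (splitAt (3 * r) k)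

  ride-u : ∀ i → ride (uI i) ≡ uI i
  ride-u i rewrite Finₚ.splitAt-↑ˡ (3 * r) i (r * K) = refl

  ride-v : ∀ j o → ride (vI j o) ≡ uI (g (j , assigned j o))
  ride-v j o rewrite Finₚ.splitAt-↑ʳ (3 * r) (r * K) (combine j o) =
    cong carrier (Finₚ.remQuot-combine {r} {K} j o)

  S : Subset (N I)
  S = Vec.tabulate (λ k → does (ride k Finₚ.≟ k))

  σ : Fin (N I) → Subset (N I)
  σ d = Vec.tabulate (λ k → does (ride k Finₚ.≟ d))

  σ⇒ride : ∀ k d → k Sub.∈ σ d → ride k ≡ d
  σ⇒ride k d k∈ = witness (ride k Finₚ.≟ d) (trans (sym (lookup∘tabulate _ k)) ([]=⇒lookup k∈))

  ride⇒σ : ∀ k d → ride k ≡ d → k Sub.∈ σ d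
  ride⇒σ k d e = lookup⇒[]= k (σ d) (trans (lookup∘tabulate _ k) (dec-true (ride k Finₚ.≟ d) e))

  u∈S : ∀ i → uI i Sub.∈ S
  u∈S i = lookup⇒[]= (uI i) S (trans (lookup∘tabulate _ (uI i)) (dec-true (ride (uI i) Finₚ.≟ uI i) (ride-u i)))

  ride-is-u : ∀ k → ∃[ i ] ride k ≡ uI i
  ride-is-u k with kind k
  ... | inj₁ (i , refl)     = i , ride-u i
  ... | inj₂ (j , o , refl) = g (j , assigned j o) , ride-v j o

  rides-along : ∀ j o → ride (vI j o) ≢ vI j o
  rides-along j o e = uI≢vI _ j o (trans (sym (ride-v j o)) e)

  ∣S∣≡3r : ∣ S ∣ ≡ 3 * r
  ∣S∣≡3r = begin
    ∣ S ∣                                                          ≡⟨ ∣∣≡count S ⟩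
    count (lookup S)                                               ≡⟨ sum-cong-≗ {N I} (cong ind ∘ lookup∘tabulate Drives) ⟩
    count Drives                                                   ≡⟨ ∑-trips (ind ∘ Drives) ⟩
    count (Drives ∘ uI) + ∑[ j < r ] count (λ o → Drives (vI j o))
      ≡⟨ cong₂ _+_ (count-all (Drives ∘ uI) u-drives) (∑-zero _ (λ j → count-none (λ o → Drives (vI j o)) (v-rides j))) ⟩
    3 * r + 0                                                      ≡⟨ +-identityʳ (3 * r) ⟩
    3 * r                                                          ∎
    where
    open ≡-Reasoning
    Drives : Fin (N I) → Bool
    Drives k = does (ride k Finₚ.≟ k)
    u-drives : ∀ i → Drives (uI i) ≡ true
    u-drives i = dec-true (ride (uI i) Finₚ.≟ uI i) (ride-u i)
    v-rides : ∀ j o → Drives (vI j o) ≡ false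
    v-rides j o = dec-false (ride (vI j o) Finₚ.≟ vI j o) (rides-along j o)

  rides-in-place : ∀ {i} j o → ride (vI j o) ≡ uI i → (j , assigned j o) ≡ place i
  rides-in-place {i} j o e = proj₁ g-bijective (trans (uI-injective (trans (sym (ride-v j o)) e)) (sym (g∘place i)))

  capacity : ∀ i → ∣ σ (uI i) ∣ ≤ a i * B + 1
  capacity i = begin
    ∣ X ∣                                                    ≡⟨ ∣∣≡count X ⟩
    count (lookup X)                                         ≡⟨ sum-cong-≗ {N I} (cong ind ∘ lookup∘tabulate Rides) ⟩
    count Rides                                              ≡⟨ ∑-trips (ind ∘ Rides) ⟩
    count (Rides ∘ uI) + ∑[ j < r ] count (λ o → Rides (vI j o))
      ≤⟨ +-mono-≤ only-itself (∑-concentrated (λ j → count (λ o → Rides (vI j o))) (proj₁ (place i)) other-blocks) ⟩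
    1 + count (λ o → Rides (vI (proj₁ (place i)) o))
      ≤⟨ +-monoʳ-≤ 1 (≤-trans (count-mono _ _ own-seat) (assigned-count (proj₁ (place i)) (proj₂ (place i)))) ⟩
    1 + seats (proj₁ (place i)) (proj₂ (place i))            ≡⟨ cong (λ x → 1 + a x * B) (g∘place i) ⟩
    1 + a i * B                                              ≡⟨ +-comm 1 _ ⟩
    a i * B + 1                                              ∎
    where
    open ≤-Reasoning
    X = σ (uI i)
    Rides : Fin (N I) → Bool
    Rides k = does (ride k Finₚ.≟ uI i)
    rides⇒ : ∀ k → Rides k ≡ true → ride k ≡ uI i
    rides⇒ k = witness (ride k Finₚ.≟ uI i)
    only-itself : count (Rides ∘ uI) ≤ 1
    only-itself = count≤1 (Rides ∘ uI) (λ x y rx ry →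
      trans (uI-injective (trans (sym (ride-u x)) (rides⇒ _ rx))) (sym (uI-injective (trans (sym (ride-u y)) (rides⇒ _ ry)))))
    in-place : ∀ j o → Rides (vI j o) ≡ true → (j , assigned j o) ≡ place i
    in-place j o ro = rides-in-place j o (rides⇒ _ ro)
    other-blocks : ∀ j → j ≢ proj₁ (place i) → count (λ o → Rides (vI j o)) ≡ 0
    other-blocks j j≢ = count-none _ (λ o → not-true (λ ro → j≢ (cong proj₁ (in-place j o ro))))
    own-seat : ∀ o → Rides (vI (proj₁ (place i)) o) ≡ true →
               does (assigned (proj₁ (place i)) o Finₚ.≟ proj₂ (place i)) ≡ true
    own-seat o ro = dec-true (assigned (proj₁ (place i)) o Finₚ.≟ proj₂ (place i)) (cong proj₂ (in-place _ o ro))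

  on-path : ∀ i p → Σ (Fin (suc (steps (pathU r i)))) λ q →
              vertAt (pathU r i) q ≡ w p × toℕ q ≡ suc (toℕ p) × distAt (pathU r i) q ≡ suc (toℕ p)
  on-path i p with chain-visits (Gr r) (λ _ → refl) r w cedge (λ j → inj₁ refl) p
  ... | q , at , index , dist = suc q , at , cong suc index , cong suc dist

  -- u_i leaves s_i at time α, drives its preferred path (arriving at D at
  -- time α + r + 1 ≤ β), and stops only at v_j for its block j
  serves-u : ∀ i → CanServe I (uI i) (σ (uI i))
  serves-u i with trip I (uI i) | trip-u i
  ... | .(uTrip r M a α β i) | refl = W , α , ≤-refl , subst (λ x → α + x ≤ β) (sym (pathU-length i)) on-time′ ,
               (W , here refl , m≤m+n _ 0) , capacity i , (v (proj₁ (place i)) ∷ [] , ≤-refl , stop) , route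
    where
    W = pathU r i
    on-time′ : α + suc r ≤ β
    on-time′ = subst (λ x → α + x ≤ β) (+-comm r 1) on-time
    at-D = on-path i (Fin.fromℕ r)
    qD = proj₁ at-D
    toℕ-qD : toℕ qD ≡ suc r
    toℕ-qD = trans (proj₁ (proj₂ (proj₂ at-D))) (cong suc (Finₚ.toℕ-fromℕ r))
    arrive : α + distAt W qD ≤ β
    arrive = subst (λ x → α + x ≤ β) (sym (trans (proj₂ (proj₂ (proj₂ at-D))) (cong suc (Finₚ.toℕ-fromℕ r)))) on-time′
    stop : ∀ k → k Sub.∈ σ (uI i) → src (trip I k) ≢ u i → src (trip I k) L.∈ (v (proj₁ (place i)) ∷ [])
    stop k k∈ other with kind k
    ... | inj₁ (i′ , refl) =
      ⊥-elim (other (trans (cong src (trip-u i′)) (cong u (uI-injective (trans (sym (ride-u i′)) (σ⇒ride _ _ k∈))))))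
    ... | inj₂ (j , o , refl) =
      here (trans (cong src (trip-v j o)) (cong v (cong proj₁ (rides-in-place j o (σ⇒ride _ _ k∈)))))
    route : ∀ k → k Sub.∈ σ (uI i) →
      ∃[ p ] ∃[ q ] (p Fin.≤ q × vertAt W p ≡ src (trip I k) × vertAt W q ≡ dst (trip I k)
                     × early (trip I k) ≤ α + distAt W p × α + distAt W q ≤ late (trip I k))
    route k k∈ with kind k
    ... | inj₁ (i′ , refl) with uI-injective (trans (sym (ride-u i′)) (σ⇒ride _ _ k∈))
    ...   | refl = zero , qD , z≤n , sym (cong src (trip-u i)) , trans (proj₁ (proj₂ at-D)) (sym (cong dst (trip-u i))) ,
                   ≤-trans (≤-reflexive (cong early (trip-u i))) (m≤m+n α 0) ,
                   ≤-trans arrive (≤-reflexive (sym (cong late (trip-u i))))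
    route k k∈ | inj₂ (j , o , refl) =
      qj , qD , qj≤qD , trans (proj₁ (proj₂ at-j)) (sym (cong src (trip-v j o))) ,
      trans (proj₁ (proj₂ at-D)) (sym (cong dst (trip-v j o))) ,
      ≤-trans (≤-reflexive (cong early (trip-v j o))) (m≤m+n α _) ,
      ≤-trans arrive (≤-reflexive (sym (cong late (trip-v j o))))
      where
      at-j = on-path i (inject₁ j)
      qj = proj₁ at-j
      qj≤qD : qj Fin.≤ qD
      qj≤qD = begin
        toℕ qj                 ≡⟨ proj₁ (proj₂ (proj₂ at-j)) ⟩
        suc (toℕ (inject₁ j))  ≡⟨ cong suc (Finₚ.toℕ-inject₁ j) ⟩
        suc (toℕ j)            ≤⟨ s≤s (<⇒≤ (Finₚ.toℕ<n j)) ⟩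
        suc r                  ≡⟨ sym toℕ-qD ⟩
        toℕ qD                 ∎
        where open ≤-Reasoning

  solution : IsSolution I S σ
  solution = drivers-serve , disjoint , covered
    where
    drivers-serve : ∀ d → d Sub.∈ S → d Sub.∈ σ d × CanServe I d (σ d)
    drivers-serve d d∈S with kind d
    ... | inj₁ (i , refl) = ride⇒σ _ _ (ride-u i) , serves-u i
    ... | inj₂ (j , o , refl) = ⊥-elim (rides-along j o (witness (ride (vI j o) Finₚ.≟ vI j o)
                                    (trans (sym (lookup∘tabulate _ (vI j o))) ([]=⇒lookup d∈S))))
    disjoint : ∀ d d′ → d Sub.∈ S → d′ Sub.∈ S → d ≢ d′ → ∀ k → k Sub.∈ σ d → k Sub.∈ σ d′ → ⊥
    disjoint d d′ _ _ d≢d′ k k∈ k∈′ = d≢d′ (trans (sym (σ⇒ride k d k∈)) (σ⇒ride k d′ k∈′))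
    covered : ∀ k → ∃[ d ] (d Sub.∈ S × k Sub.∈ σ d)
    covered k = ride k , subst (Sub._∈ S) (sym (proj₂ (ride-is-u k))) (u∈S _) , ride⇒σ k _ refl

module Reverse (r M : ℕ) (a : Fin (3 * r) → ℕ) (α β : ℕ)
  (bounds : ∀ i → M < 4 * a i × 2 * a i < M) (M>0 : 0 < M) (∑a≡rM : sumF a ≡ r * M)
  (S : Subset (N (construct r M a α β)))
  (σ : Fin (N (construct r M a α β)) → Subset (N (construct r M a α β)))
  (sol : IsSolution (construct r M a α β) S σ) (few : ∣ S ∣ < 3 * r + r * M) where
  open Indexing r M a α β

  driver : Fin (N I) → Fin (N I)
  driver k = proj₁ (proj₂ (proj₂ sol) k)

  driver∈S : ∀ k → driver k Sub.∈ S
  driver∈S k = proj₁ (proj₂ (proj₂ (proj₂ sol) k))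

  served : ∀ k → k Sub.∈ σ (driver k)
  served k = proj₂ (proj₂ (proj₂ (proj₂ sol) k))

  driven-by : ∀ k d → driver k ≡ d → d Sub.∈ S × k Sub.∈ σ d
  driven-by k d refl = driver∈S k , served k

  serves : ∀ d → d Sub.∈ S → CanServe I d (σ d)
  serves d d∈S = proj₂ (proj₁ sol d d∈S)

  self-served : ∀ d → d Sub.∈ S → d Sub.∈ σ d
  self-served d d∈S = proj₁ (proj₁ sol d d∈S)

  capacity : ∀ d → d Sub.∈ S → ∣ σ d ∣ ≤ cap (trip I d) + 1
  capacity d d∈S = proj₁ (proj₂ (proj₂ (proj₂ (proj₂ (proj₂ (serves d d∈S))))))

  ∣∣-by-kind : (X : Subset (N I)) →
    ∣ X ∣ ≡ count (λ i → lookup X (uI i)) + ∑[ j < r ] count (λ o → lookup X (vI j o))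
  ∣∣-by-kind X = trans (∣∣≡count X) (∑-trips (ind ∘ lookup X))

  -- an extra trip has capacity 0, so as a driver it serves only itself
  v-alone : ∀ j o x → vI j o Sub.∈ S → x Sub.∈ σ (vI j o) → x ≡ vI j o
  v-alone j o x d∈S x∈ with x Finₚ.≟ vI j o
  ... | yes x≡d = x≡d
  ... | no  x≢d with ≤-trans (two≤count (lookup X) x (vI j o) x≢d ([]=⇒lookup x∈) ([]=⇒lookup (self-served _ d∈S)))
                             (≤-trans (≤-reflexive (sym (∣∣≡count X)))
                                      (subst (λ T → ∣ X ∣ ≤ cap T + 1) (trip-v j o) (capacity _ d∈S)))
    where X = σ (vI j o)
  ...   | s≤s ()

  -- every u-trip drives itself: it cannot ride with an extra trip (capacity 0),
  -- nor with another u-trip u_i′, whose detour-free route never visits u_i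
  u-drives : ∀ i → driver (uI i) ≡ uI i
  u-drives i with kind (driver (uI i))
  ... | inj₂ (j , o , e) = ⊥-elim (uI≢vI i j o (v-alone j o (uI i) d∈S i∈))
    where
    d∈S = proj₁ (driven-by (uI i) (vI j o) e)
    i∈  = proj₂ (driven-by (uI i) (vI j o) e)
  ... | inj₁ (i′ , e) = trans e (cong uI (sym (same e)))
    where
    same : driver (uI i) ≡ uI i′ → i ≡ i′
    same e with trip I (uI i′) | trip-u i′ | serves (uI i′) (proj₁ (driven-by (uI i) (uI i′) e))
    ... | .(uTrip r M a α β i′) | refl | W , _ , _ , _ , (P , here refl , W≤P) , _ , _ , routes
      with routes (uI i) (proj₂ (driven-by (uI i) (uI i′) e))
    ... | p , _ , _ , at , _ =
      visits-only-own-u r i i′ W (≤-trans W≤P (≤-reflexive (trans (+-identityʳ _) (pathU-length i′))))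
                        p (trans at (cong src (trip-u i)))

  v-carried : ∀ j o → driver (vI j o) ≢ vI j o → ∃[ i ] driver (vI j o) ≡ uI i
  v-carried j o not-self with kind (driver (vI j o))
  ... | inj₁ found = found
  ... | inj₂ (j′ , o′ , e) = ⊥-elim (not-self (trans e (sym (v-alone j′ o′ (vI j o) d∈S k∈))))
    where
    d∈S = proj₁ (driven-by (vI j o) (vI j′ o′) e)
    k∈  = proj₂ (driven-by (vI j o) (vI j′ o′) e)

  carries : Fin (3 * r) → Fin r → Fin K → Bool
  carries i j o = does (driver (vI j o) Finₚ.≟ uI i)

  stops-at : Fin (3 * r) → Fin r → Bool
  stops-at i j = does (Finₚ.any? (λ o → driver (vI j o) Finₚ.≟ uI i))

  self-driving : Fin r → Fin K → Bool
  self-driving j o = does (driver (vI j o) Finₚ.≟ vI j o)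

  -- stop limit 1: each u-trip stops at no more than one chain vertex
  one-stop : ∀ i j j′ → stops-at i j ≡ true → stops-at i j′ ≡ true → j ≡ j′
  one-stop i j j′ at-j at-j′
    with witness (Finₚ.any? (λ o → driver (vI j o) Finₚ.≟ uI i)) at-j
       | witness (Finₚ.any? (λ o → driver (vI j′ o) Finₚ.≟ uI i)) at-j′
  ... | o , e | o′ , e′
    with trip I (uI i) | trip-u i | serves (uI i) (proj₁ (driven-by (vI j o) (uI i) e))
  ... | .(uTrip r M a α β i) | refl | _ , _ , _ , _ , _ , _ , (Ls , ∣Ls∣≤1 , listed) , _ =
    v-injective r (≤1-member Ls ∣Ls∣≤1 (stop j o e) (stop j′ o′ e′))
    where
    stop : ∀ j o → driver (vI j o) ≡ uI i → v j L.∈ Ls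
    stop j o e = subst (L._∈ Ls) (cong src (trip-v j o))
      (listed (vI j o) (proj₂ (driven-by (vI j o) (uI i) e))
              (λ same-src → v≢u (trans (sym (cong src (trip-v j o))) same-src)))
      where
      v≢u : v j ≢ u i
      v≢u ()

  drivers-lower : 3 * r + ∑[ j < r ] count (self-driving j) ≤ ∣ S ∣
  drivers-lower = begin
    3 * r + ∑[ j < r ] count (self-driving j)
      ≤⟨ +-mono-≤ (≤-reflexive (sym (count-all (λ i → lookup S (uI i)) u∈S))) (∑-mono (λ j → count-mono _ _ (v∈S j))) ⟩
    count (λ i → lookup S (uI i)) + ∑[ j < r ] count (λ o → lookup S (vI j o))
      ≡⟨ sym (∣∣-by-kind S) ⟩
    ∣ S ∣ ∎
    where
    open ≤-Reasoning
    u∈S : ∀ i → lookup S (uI i) ≡ true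
    u∈S i = []=⇒lookup (subst (Sub._∈ S) (u-drives i) (driver∈S (uI i)))
    v∈S : ∀ j o → self-driving j o ≡ true → lookup S (vI j o) ≡ true
    v∈S j o self = []=⇒lookup (subst (Sub._∈ S) (witness (driver (vI j o) Finₚ.≟ vI j o) self) (driver∈S (vI j o)))

  few-self-driving : ∑[ j < r ] count (self-driving j) < B
  few-self-driving = +-cancelˡ-≤ (3 * r) _ _ (≤-trans (≤-reflexive (+-suc (3 * r) _)) (≤-trans (s≤s drivers-lower) few))

  carried≤ : ∀ i j → count (carries i j) ≤ ind (stops-at i j) * (a i * B)
  carried≤ i j with stops-at i j in at-j
  ... | false = ≤-reflexive (count-none (carries i j) not-carried)
    where
    not-carried : ∀ o → carries i j o ≡ false
    not-carried o with carries i j o in c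
    ... | false = refl
    ... | true with trans (sym (dec-true (Finₚ.any? (λ o → driver (vI j o) Finₚ.≟ uI i))
                                         (o , witness (driver (vI j o) Finₚ.≟ uI i) c))) at-j
    ...   | ()
  ... | true = ≤-trans (+-cancelˡ-≤ 1 _ _ (≤-trans served≥ (≤-reflexive (+-comm (a i * B) 1))))
                       (≤-reflexive (sym (+-identityʳ _)))
    where
    X = σ (uI i)
    u∈S : uI i Sub.∈ S
    u∈S = subst (Sub._∈ S) (u-drives i) (driver∈S (uI i))
    carried∈X : ∀ o → carries i j o ≡ true → lookup X (vI j o) ≡ true
    carried∈X o c = []=⇒lookup (proj₂ (driven-by (vI j o) (uI i) (witness (driver (vI j o) Finₚ.≟ uI i) c)))
    served≥ : 1 + count (carries i j) ≤ a i * B + 1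
    served≥ = begin
      1 + count (carries i j)
        ≤⟨ +-mono-≤ (count-pos (λ i′ → lookup X (uI i′)) i ([]=⇒lookup (self-served _ u∈S)))
                    (≤-trans (count-mono (carries i j) (λ o → lookup X (vI j o)) carried∈X)
                             (term≤∑ (λ j′ → count (λ o → lookup X (vI j′ o))) j)) ⟩
      count (λ i′ → lookup X (uI i′)) + ∑[ j′ < r ] count (λ o → lookup X (vI j′ o))
        ≡⟨ sym (∣∣-by-kind X) ⟩
      ∣ X ∣
        ≤⟨ subst (λ T → ∣ X ∣ ≤ cap T + 1) (trip-u i) (capacity _ u∈S) ⟩
      a i * B + 1 ∎
      where open ≤-Reasoning

  load : Fin r → ℕ
  load j = ∑[ i < 3 * r ] (ind (stops-at i j) * a i)

  block-cover : ∀ j → K ≤ count (self-driving j) + load j * B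
  block-cover j = begin
    K                                                   ≡⟨ sym (count-compl (self-driving j)) ⟩
    self + count (not ∘ self-driving j)                 ≤⟨ +-monoʳ-≤ self (count-union _ (λ i → carries i j) carried) ⟩
    self + ∑[ i < 3 * r ] count (carries i j)           ≤⟨ +-monoʳ-≤ self (∑-mono (λ i → carried≤ i j)) ⟩
    self + ∑[ i < 3 * r ] (ind (stops-at i j) * (a i * B)) ≡⟨ cong (self +_) regroup ⟩
    self + load j * B                                   ∎
    where
    open ≤-Reasoning
    self = count (self-driving j)
    carried : ∀ o → not (self-driving j o) ≡ true → ∃[ i ] carries i j o ≡ true
    carried o other with v-carried j o (refutation (driver (vI j o) Finₚ.≟ vI j o) other)
    ... | i , e = i , dec-true (driver (vI j o) Finₚ.≟ uI i) e
    regroup : ∑[ i < 3 * r ] (ind (stops-at i j) * (a i * B)) ≡ load j * B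
    regroup = trans (sum-cong-≗ {3 * r} (λ i → sym (*-assoc (ind (stops-at i j)) (a i) B)))
                    (sym (*-distribʳ-sum B (λ i → ind (stops-at i j) * a i)))

  -- every chain vertex needs a load of at least M: otherwise at least
  -- (M ∸ load j) · B ≥ B of its extra trips would have to drive themselves
  load≥M : ∀ j → M ≤ load j
  load≥M j = ≮⇒≥ λ load<M →
    <⇒≱ few-self-driving (≤-trans (B≤self load<M) (term≤∑ (λ j → count (self-driving j)) j))
    where
    B≤self : load j < M → B ≤ count (self-driving j)
    B≤self load<M = +-cancelʳ-≤ (load j * B) B (count (self-driving j)) (begin
      B + load j * B   ≡⟨⟩
      suc (load j) * B ≤⟨ *-monoˡ-≤ B load<M ⟩
      M * B            ≡⟨ *-comm M B ⟩
      K                ≤⟨ block-cover j ⟩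
      count (self-driving j) + load j * B ∎)
      where open ≤-Reasoning

  stops : Fin (3 * r) → ℕ
  stops i = count (stops-at i)

  stops≤1 : ∀ i → stops i ≤ 1
  stops≤1 i = count≤1 (stops-at i) (one-stop i)

  ∑load : ∑[ j < r ] load j ≡ ∑[ i < 3 * r ] (stops i * a i)
  ∑load = trans (sym (∑-comm (λ i j → ind (stops-at i j) * a i)))
                (sum-cong-≗ {3 * r} (λ i → sym (*-distribʳ-sum (a i) (λ j → ind (stops-at i j)))))

  ∑a : ∑[ i < 3 * r ] a i ≡ r * M
  ∑a = trans (sym (sumL-tabulate a)) ∑a≡rM

  ∑load≥rM : r * M ≤ ∑[ j < r ] load j
  ∑load≥rM = ≤-trans (≤-reflexive (sym (∑-const r M))) (∑-mono load≥M)

  -- every u-trip stops somewhere: the loads already use up all of Σ a,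
  -- so no a i (which is positive) can be left out
  has-stop : ∀ i → ∃[ j ] stops-at i j ≡ true
  has-stop i with Finₚ.any? (λ j → stops-at i j ≟ᵇ true)
  ... | yes found = found
  ... | no  none  = ⊥-elim (n≮0 (subst (M <_) (cong (4 *_) (n≤0⇒n≡0 ai≤0)) (proj₁ (bounds i))))
    where
    no-stop : stops i ≡ 0
    no-stop = count-none (stops-at i) (λ j → not-true (λ at → none (j , at)))
    ai≤0 : a i ≤ 0
    ai≤0 = +-cancelˡ-≤ (r * M) _ _ (begin
      r * M + a i                         ≤⟨ +-monoˡ-≤ (a i) (≤-trans ∑load≥rM (≤-reflexive ∑load)) ⟩
      ∑[ i < 3 * r ] (stops i * a i) + a i ≤⟨ ∑-avoiding stops a stops≤1 i no-stop ⟩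
      ∑[ i < 3 * r ] a i                  ≡⟨ ∑a ⟩
      r * M                               ≡⟨ sym (+-identityʳ _) ⟩
      r * M + 0                           ∎)
      where open ≤-Reasoning

  load≡M : ∀ j → load j ≡ M
  load≡M = all-equal load M load≥M (begin
    ∑[ j < r ] load j                ≡⟨ ∑load ⟩
    ∑[ i < 3 * r ] (stops i * a i)   ≤⟨ ∑-mono (λ i → weighted≤ (a i) (stops≤1 i)) ⟩
    ∑[ i < 3 * r ] a i               ≡⟨ ∑a ⟩
    r * M                            ∎)
    where open ≤-Reasoning

  block : Fin (3 * r) → Fin r
  block i = proj₁ (has-stop i)

  in-block : ∀ i j → fibre block j i ≡ stops-at i j
  in-block i j with block i Finₚ.≟ j
  ... | yes refl = sym (proj₂ (has-stop i))
  ... | no  i∉j  = sym (not-true (λ at → i∉j (one-stop i (block i) j (proj₂ (has-stop i)) at)))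

  partition : HasThreePartition r M a
  partition = partition-from-blocks r M a bounds M>0 block
    (λ j → trans (sum-cong-≗ {3 * r} (λ i → cong (λ b → ind b * a i) (in-block i j))) (load≡M j))

-- The theorem.  Its hypothesis α < β is implied by α + (r + 1) ≤ β and
-- not needed separately; 2 ≤ r is only used to exclude r = 0.

SmallSolution : (r M : ℕ) (a : Fin (3 * r) → ℕ) (α β : ℕ) → Set
SmallSolution r M a α β =
  Σ (Subset (N (construct r M a α β))) (λ S →
  Σ (Fin (N (construct r M a α β)) → Subset (N (construct r M a α β))) (λ σ →
    IsSolution (construct r M a α β) S σ × 3 * r ≤ ∣ S ∣ × ∣ S ∣ < 3 * r + r * M))

lemma2 : (r M : ℕ) (a : Fin (3 * r) → ℕ) (α β : ℕ) →
         2 ≤ r →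
         sumF a ≡ r * M →
         (∀ i → M < 4 * a i × 2 * a i < M) →
         α < β →
         α + (r + 1) ≤ β →
         HasThreePartition r M a ⇔
           Σ (Subset (N (construct r M a α β))) (λ S →
           Σ (Fin (N (construct r M a α β)) → Subset (N (construct r M a α β))) (λ σ →
             IsSolution (construct r M a α β) S σ × 3 * r ≤ ∣ S ∣ × ∣ S ∣ < 3 * r + r * M))
lemma2 zero        M a α β () ∑a≡rM bounds _ on-time
lemma2 r@(suc _) M a α β _  ∑a≡rM bounds _ on-time = mk⇔ to from
  where
  -- M > 2 a₀ ≥ 0
  M>0 : 0 < M
  M>0 = ≤-trans (s≤s z≤n) (proj₂ (bounds zero))
  to : HasThreePartition r M a → SmallSolution r M a α β
  to (g , g-bijective , row-sum) =
    S , σ , solution , ≤-reflexive (sym ∣S∣≡3r) ,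
    subst (_< 3 * r + r * M) (sym ∣S∣≡3r) (m<m+n (3 * r) (*-mono-≤ {1} {r} {1} {M} (s≤s z≤n) M>0))
    where open Forward r M a α β on-time g g-bijective row-sum
  from : SmallSolution r M a α β → HasThreePartition r M a
  from (S , σ , sol , _ , few) = Reverse.partition r M a α β bounds M>0 ∑a≡rM S σ sol few
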